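{- Every family $(\mathcal{A}_i)_{i\in I}$ of finiteness spaces admits a least upper bound $\bigsqcup_{i\in I}\mathcal{A}_i$ (their finiteness supremum) and a greatest lower bound $\mathop{\sqcap}_{i\in I}\mathcal{A}_i$ (their finiteness infimum) for the finiteness inclusion order. They are given by: the web of $\bigsqcup_{i\in I}\mathcal{A}_i$ is $\bigcup_{i\in I}|\mathcal{A}_i|$; the web of $\mathop{\sqcap}_{i\in I}\mathcal{A}_i$ is $\bigcap_{i\in I}|\mathcal{A}_i|$; the finiteness structure of $\bigsqcup_{i\in I}\mathcal{A}_i$ is the bidual $\left(\bigcup_{i\in I}\mathfrak{F}(\mathcal{A}_i)\right)^{\perp\perp}$ taken relative to the set $\bigcup_{i\in I}|\mathcal{A}_i|$; and the finiteness structure of $\mathop{\sqcap}_{i\in I}\mathcal{A}_i$ is $\bigcap_{i\in I}\mathfrak{F}(\mathcal{A}_i)$. Hence finiteness spaces form a complete lattice with respect to finiteness inclusion $\sqsubseteq$.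
   Context: For sets $A,B$, write $A\perp_f B$ if $A\cap B$ is finite. For $\mathfrak{A}\subseteq\mathcal{P}(A)$, the predual of $\mathfrak{A}$ on $A$ is $\mathfrak{A}^{\perp}=\{a'\subseteq A : \forall a\in\mathfrak{A},\ a\perp_f a'\}$, and the bidual is $\mathfrak{A}^{\perp\perp}=(\mathfrak{A}^{\perp})^{\perp}$ (both relative to $A$). A finiteness structure on $A$ is a set $\mathfrak{A}$ of subsets of $A$ with $\mathfrak{A}^{\perp\perp}=\mathfrak{A}$. A finiteness space is a pair $\mathcal{A}=(|\mathcal{A}|,\mathfrak{F}(\mathcal{A}))$ where $|\mathcal{A}|$ is a set (the web) and $\mathfrak{F}(\mathcal{A})$ is a finiteness structure on $|\mathcal{A}|$. Finiteness inclusion: $\mathcal{A}\sqsubseteq\mathcal{B}$ iff $|\mathcal{A}|\subseteq|\mathcal{B}|$ and $\mathfrak{F}(\mathcal{A})\subseteq\mathfrak{F}(\mathcal{B})$. -}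

module Defs where

open import Level using (Level; suc)
open import Data.Product using (Σ; _×_)
open import Data.List using (List)
open import Data.List.Membership.Propositional using (_∈_)
open import Relation.Unary using (Pred; _⊆_; _∩_; _≐_; ⋃; ⋂)

-- Points live in a fixed ambient type U (needed so that the empty
-- intersection of webs makes sense).  Subsets of U are predicates.

private
  variable
    ℓ : Level

Finite : {U : Set ℓ} → Pred U ℓ → Set ℓ
Finite {U = U} S = Σ (List U) (λ xs → S ⊆ (λ x → x ∈ xs))

_⊥f_ : {U : Set ℓ} → Pred U ℓ → Pred U ℓ → Set ℓ
a ⊥f b = Finite (a ∩ b)

predual : {U : Set ℓ} → Pred U ℓ → Pred (Pred U ℓ) (suc ℓ) → Pred (Pred U ℓ) (suc ℓ)
predual W 𝔄 = λ a' → (a' ⊆ W) × (∀ a → 𝔄 a → a ⊥f a')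

bidual : {U : Set ℓ} → Pred U ℓ → Pred (Pred U ℓ) (suc ℓ) → Pred (Pred U ℓ) (suc ℓ)
bidual W 𝔄 = predual W (predual W 𝔄)

IsFinStructure : {U : Set ℓ} → Pred U ℓ → Pred (Pred U ℓ) (suc ℓ) → Set (suc ℓ)
IsFinStructure W 𝔄 = bidual W 𝔄 ≐ 𝔄

record FinSpace (U : Set ℓ) : Set (suc (suc ℓ)) where
  field
    web   : Pred U ℓ
    fin   : Pred (Pred U ℓ) (suc ℓ)
    isFin : IsFinStructure web fin
open FinSpace public

_⊑_ : {U : Set ℓ} → FinSpace U → FinSpace U → Set (suc ℓ)
A ⊑ B = (web A ⊆ web B) × (fin A ⊆ fin B)

IsLUB : {U : Set ℓ} {I : Set ℓ} → (I → FinSpace U) → FinSpace U → Set (suc (suc ℓ))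
IsLUB {U = U} {I = I} A S = (∀ i → A i ⊑ S) × (∀ (B : FinSpace U) → (∀ i → A i ⊑ B) → S ⊑ B)

IsGLB : {U : Set ℓ} {I : Set ℓ} → (I → FinSpace U) → FinSpace U → Set (suc (suc ℓ))
IsGLB {U = U} {I = I} A S = (∀ i → S ⊑ A i) × (∀ (B : FinSpace U) → (∀ i → B ⊑ A i) → B ⊑ S)

module Submission where

-- Everything rests on three facts about the duality a ⊥f a' ("a ∩ a' finite")
-- relative to a web W:
--   * bidual W X contains X whenever every member of X lies in W
--     (extensivity), and bidual W X is itself a finiteness structure;
--   * bidual is monotone in BOTH arguments: shrinking the web and the family
--     shrinks the bidual (a dual element b' over the big web restricts to
--     the dual element b' ∩ W over the small one);
--   * a finiteness structure equals its own bidual, so its members lie in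
--     its web.
-- The supremum is (⋃ webs , (⋃ structures)^⊥⊥); it lies above each A i by
-- extensivity and below every upper bound B by monotonicity of the bidual,
-- since fin B = bidual (web B) (fin B).  The infimum is (⋂ webs , ⋂
-- structures); the same monotonicity shows that ⋂ structures is closed
-- under bidual, i.e. is a finiteness structure, and its bounds are immediate.

open import Defs
open import Level using (Level)
open import Data.Product using (Σ; _×_; _,_; proj₁; proj₂)
open import Relation.Binary.PropositionalEquality using (_≡_; refl)
open import Relation.Unary using (⋃; ⋂; Pred; _⊆_; _∩_)

module _ {ℓ : Level} {U : Set ℓ} where

  finite-⊆ : {S T : Pred U ℓ} → S ⊆ T → Finite T → Finite S
  finite-⊆ S⊆T (xs , T⊆xs) = xs , λ s → T⊆xs (S⊆T s)

  ⊥f-sym : {a b : Pred U ℓ} → a ⊥f b → b ⊥f a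
  ⊥f-sym = finite-⊆ (λ (x∈b , x∈a) → x∈a , x∈b)

  bidual-extensive : (W : Pred U ℓ) {X : Pred (Pred U ℓ) (Level.suc ℓ)} →
    (∀ {a} → X a → a ⊆ W) → X ⊆ bidual W X
  bidual-extensive W X⊆W {a} a∈X = X⊆W a∈X , λ a' a'∈X⊥ → ⊥f-sym (proj₂ a'∈X⊥ a a∈X)

  predual-antitone : (W : Pred U ℓ) {X Y : Pred (Pred U ℓ) (Level.suc ℓ)} →
    X ⊆ Y → predual W Y ⊆ predual W X
  predual-antitone W X⊆Y (a'⊆W , a'⊥Y) = a'⊆W , λ a a∈X → a'⊥Y a (X⊆Y a∈X)

  -- A bidual is a finiteness structure: X^⊥⊥⊥ = X^⊥.
  bidual-isFinStructure : (W : Pred U ℓ) (X : Pred (Pred U ℓ) (Level.suc ℓ)) →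
    IsFinStructure W (bidual W X)
  bidual-isFinStructure W X =
    predual-antitone W (bidual-extensive W proj₁) , bidual-extensive W proj₁

  -- The bidual is monotone in the web and in the family: a dual element b'
  -- of Y over V restricts to the dual element b' ∩ W of X over W.
  bidual-mono : {W V : Pred U ℓ} {X Y : Pred (Pred U ℓ) (Level.suc ℓ)} →
    W ⊆ V → X ⊆ Y → bidual W X ⊆ bidual V Y
  bidual-mono {W} {V} {X} {Y} W⊆V X⊆Y {a} (a⊆W , a⊥X⊥) =
    (λ x∈a → W⊆V (a⊆W x∈a)) , b'⊥a
    where
    b'⊥a : ∀ b' → predual V Y b' → b' ⊥f a
    b'⊥a b' b'∈Y⊥ = finite-⊆ (λ (x∈b' , x∈a) → (x∈b' , a⊆W x∈a) , x∈a)
                             (a⊥X⊥ (b' ∩ W) restricted)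
      where
      restricted : predual W X (b' ∩ W)
      restricted = proj₂ , λ c c∈X → finite-⊆ (λ (x∈c , (x∈b' , _)) → x∈c , x∈b')
                                               (proj₂ b'∈Y⊥ c (X⊆Y c∈X))

  fin-⊆-web : (A : FinSpace U) {a : Pred U ℓ} → fin A a → a ⊆ web A
  fin-⊆-web A a∈A = proj₁ (proj₂ (isFin A) a∈A)

  -- The bidual of a family X over W lies in fin B once W ⊆ web B and X ⊆ fin B,
  -- because fin B is its own bidual over web B.
  bidual-⊆-fin : (B : FinSpace U) {W : Pred U ℓ} {X : Pred (Pred U ℓ) (Level.suc ℓ)} →
    W ⊆ web B → X ⊆ fin B → bidual W X ⊆ fin B
  bidual-⊆-fin B W⊆B X⊆B a∈X⊥⊥ = proj₁ (isFin B) (bidual-mono W⊆B X⊆B a∈X⊥⊥)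

module _ {ℓ : Level} {U : Set ℓ} {I : Set ℓ} (A : I → FinSpace U) where

  ⋃web ⋂web : Pred U ℓ
  ⋃web = ⋃ I (λ i → web (A i))
  ⋂web = ⋂ I (λ i → web (A i))

  ⋃fin ⋂fin : Pred (Pred U ℓ) (Level.suc ℓ)
  ⋃fin = ⋃ I (λ i → fin (A i))
  ⋂fin = ⋂ I (λ i → fin (A i))

  ⨆ : FinSpace U
  ⨆ = record { web = ⋃web ; fin = bidual ⋃web ⋃fin
             ; isFin = bidual-isFinStructure ⋃web ⋃fin }

  ⨆-isLUB : IsLUB A ⨆
  ⨆-isLUB = upper , least
    where
    upper : ∀ i → A i ⊑ ⨆
    upper i = (λ x → i , x)
            , λ a∈Ai → bidual-extensive ⋃web (λ (j , a∈Aj) x∈a → j , fin-⊆-web (A j) a∈Aj x∈a)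
                                        (i , a∈Ai)
    least : ∀ B → (∀ i → A i ⊑ B) → ⨆ ⊑ B
    least B A⊑B = web⊆ , bidual-⊆-fin B web⊆ (λ (i , a∈Ai) → proj₂ (A⊑B i) a∈Ai)
      where
      web⊆ : ⋃web ⊆ web B
      web⊆ (i , x∈Ai) = proj₁ (A⊑B i) x∈Ai

  ⋂fin-isFinStructure : IsFinStructure ⋂web ⋂fin
  ⋂fin-isFinStructure =
      (λ a∈X⊥⊥ i → bidual-⊆-fin (A i) (λ x∈⋂ → x∈⋂ i) (λ a∈⋂ → a∈⋂ i) a∈X⊥⊥)
    , bidual-extensive ⋂web (λ a∈⋂ x∈a i → fin-⊆-web (A i) (a∈⋂ i) x∈a)

  ⨅ : FinSpace U
  ⨅ = record { web = ⋂web ; fin = ⋂fin ; isFin = ⋂fin-isFinStructure }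

  ⨅-isGLB : IsGLB A ⨅
  ⨅-isGLB = (λ i → (λ x∈⋂ → x∈⋂ i) , λ a∈⋂ → a∈⋂ i)
          , λ B B⊑A → (λ x∈B i → proj₁ (B⊑A i) x∈B) , λ a∈B i → proj₂ (B⊑A i) a∈B

lemma6 : {ℓ : Level} (U : Set ℓ) (I : Set ℓ) (A : I → FinSpace U) →
    Σ (FinSpace U) (λ S → (web S ≡ ⋃ I (λ i → web (A i))) × (fin S ≡ bidual (⋃ I (λ i → web (A i))) (⋃ I (λ i → fin (A i)))) × IsLUB A S)
    × Σ (FinSpace U) (λ T → (web T ≡ ⋂ I (λ i → web (A i))) × (fin T ≡ ⋂ I (λ i → fin (A i))) × IsGLB A T)
lemma6 U I A = (⨆ A , refl , refl , ⨆-isLUB A) , (⨅ A , refl , refl , ⨅-isGLB A)
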